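{- Let $W_{\Delta,n}$ be a Knödel graph with $\Delta\ge2$ and $s=2^{\Delta-1}-1$. If $1\le i\le\lfloor n/4\rfloor$, then $d(u_0,u_i)\ge 2\lceil i/s\rceil$.
   Context: Knödel graph: for an even integer $n$ and an integer $\Delta$ with $1\le\Delta\le\lfloor\log_2 n\rfloor$, $W_{\Delta,n}$ is the simple bipartite graph with vertex set $U\cup V$, $U=\{u_0,\dots,u_{n/2-1}\}$, $V=\{v_0,\dots,v_{n/2-1}\}$; indices are read modulo $n/2$. The vertices $u_i$ and $v_j$ are adjacent iff $j-i\equiv 2^k-1\pmod{n/2}$ for some $k\in\{0,\dots,\Delta-1\}$; no other edges. $d(x,y)$ is the graph distance. -}

module Defs where

open import Data.Nat using (ℕ; zero; suc; _+_; _*_; _∸_; _^_; _<_; _≤_; _/_; _%_)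
open import Data.Fin using (Fin; toℕ)
open import Data.Product using (Σ; _×_; _,_)
open import Relation.Binary.PropositionalEquality using (_≡_)

-- reduction of a natural number modulo m (m = 0 never occurs for a nonempty graph)
reduce : ℕ → ℕ → ℕ
reduce a zero    = a
reduce a (suc m) = a % suc m

-- ceiling division ⌈ a / b ⌉ (junk value 0 for b = 0, never used)
⌈_/_⌉ : ℕ → ℕ → ℕ
⌈ a / zero  ⌉ = 0
⌈ a / suc b ⌉ = (a + b) / suc b

data Side : Set where
  U V : Side

-- vertices of W_{Δ,n}, where m = n/2: u_i = (U , i), v_j = (V , j)
Vertex : ℕ → Set
Vertex m = Side × Fin m

KEdge : (Δ m : ℕ) → Fin m → Fin m → Set
KEdge Δ m i j = Σ ℕ λ k → (k < Δ) × (toℕ j ≡ reduce (toℕ i + (2 ^ k ∸ 1)) m)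

data Adj (Δ m : ℕ) : Vertex m → Vertex m → Set where
  uv : ∀ {i j} → KEdge Δ m i j → Adj Δ m (U , i) (V , j)
  vu : ∀ {i j} → KEdge Δ m i j → Adj Δ m (V , j) (U , i)

data Walk (Δ m : ℕ) : Vertex m → Vertex m → Set where
  []  : ∀ {x} → Walk Δ m x x
  _∷_ : ∀ {x y z} → Adj Δ m x y → Walk Δ m y z → Walk Δ m x z

length : ∀ {Δ m x y} → Walk Δ m x y → ℕ
length []       = 0
length (_ ∷ w)  = suc (length w)

-- d(x,y) ≥ b  :  every walk from x to y has length at least b
-- (graph distance = minimum walk length; = ∞ if no walk exists)
DistGE : (Δ m : ℕ) → Vertex m → Vertex m → ℕ → Set
DistGE Δ m x y b = (w : Walk Δ m x y) → b ≤ length w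

-- Write m = n/2.  Every edge uᵢ vⱼ satisfies j ≡ i + c (mod m) with
-- 0 ≤ c ≤ s, since 2^k - 1 ≤ 2^(Δ-1) - 1 for k < Δ.  As the graph is
-- bipartite, a walk from u_a to u_b has even length 2t and splits into t
-- round trips u → v → u', each moving the index by c₁ - c₂ with c₁, c₂ ≤ s.
-- Hence b ≡ a + δ (mod m) for some |δ| ≤ ts: u_b is within cyclic distance ts
-- of u_a.  For a = 0, b = i and 2i ≤ m the cyclic distance from 0 to i is i,
-- so i ≤ ts, i.e. t ≥ ⌈i/s⌉, and the walk has length 2t ≥ 2⌈i/s⌉.
module Submission where

open import Defs
open import Data.Nat using (ℕ; zero; suc; _+_; _*_; _∸_; _^_; _≤_; _<_; _/_; _%_; z≤n; s≤s)
open import Data.Nat.Logarithm using (⌊log₂_⌋)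
open import Data.Nat.Properties
open import Data.Nat.DivMod using (m≡m%n+[m/n]*n; m/n*n≤m; m<n*o⇒m/o<n; m/n/o≡m/[n*o])
open import Data.Fin using (Fin; toℕ)
open import Data.Product using (Σ; _×_; _,_)
open import Data.Sum using (_⊎_; inj₁; inj₂)
open import Data.Empty using (⊥-elim)
open import Relation.Binary.PropositionalEquality
  using (_≡_; refl; sym; trans; cong; subst₂; module ≡-Reasoning)

-- Congruence modulo m, stated subtraction-free: a + x·m = b + y·m.
ModEq : ℕ → ℕ → ℕ → Set
ModEq m a b = Σ ℕ λ x → Σ ℕ λ y → a + x * m ≡ b + y * m

modEq-reflexive : ∀ {m a b} → a ≡ b → ModEq m a b
modEq-reflexive refl = 0 , 0 , refl

modEq-sym : ∀ {m a b} → ModEq m a b → ModEq m b a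
modEq-sym (x , y , e) = y , x , sym e

+-swapʳ : ∀ a b c → a + b + c ≡ a + c + b
+-swapʳ a b c = trans (+-assoc a b c) (trans (cong (a +_) (+-comm b c)) (sym (+-assoc a c b)))

+-multiples : ∀ m a x x' → a + (x + x') * m ≡ a + x * m + x' * m
+-multiples m a x x' = trans (cong (a +_) (*-distribʳ-+ m x x')) (sym (+-assoc a (x * m) (x' * m)))

modEq-trans : ∀ {m a b c} → ModEq m a b → ModEq m b c → ModEq m a c
modEq-trans {m} {a} {b} {c} (x , y , e) (x' , y' , e') = x + x' , y' + y , (begin
    a + (x + x') * m    ≡⟨ +-multiples m a x x' ⟩
    a + x * m + x' * m  ≡⟨ cong (_+ x' * m) e ⟩
    b + y * m + x' * m  ≡⟨ +-swapʳ b (y * m) (x' * m) ⟩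
    b + x' * m + y * m  ≡⟨ cong (_+ y * m) e' ⟩
    c + y' * m + y * m  ≡⟨ sym (+-multiples m c y' y) ⟩
    c + (y' + y) * m    ∎)
  where open ≡-Reasoning

modEq-+ʳ : ∀ {m a b} k → ModEq m a b → ModEq m (a + k) (b + k)
modEq-+ʳ {m} {a} {b} k (x , y , e) =
  x , y , trans (+-swapʳ a k (x * m)) (trans (cong (_+ k) e) (+-swapʳ b (y * m) k))

modEq-cancelʳ : ∀ {m a b} k → ModEq m (a + k) (b + k) → ModEq m a b
modEq-cancelʳ {m} {a} {b} k (x , y , e) =
  x , y , +-cancelʳ-≡ k _ _ (trans (+-swapʳ a (x * m) k) (trans e (+-swapʳ b k (y * m))))

reduce-modEq : ∀ a m → ModEq m (reduce a m) a
reduce-modEq a zero    = modEq-reflexive refl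
reduce-modEq a (suc m) = a / suc m , 0 , trans (sym (m≡m%n+[m/n]*n a (suc m))) (sym (+-identityʳ a))

Shift : ℕ → ℕ → ℕ → ℕ → Set
Shift m K p q = Σ ℕ λ d → d ≤ K × ModEq m (p + d) q

Near : ℕ → ℕ → ℕ → ℕ → Set
Near m K p q = Shift m K p q ⊎ Shift m K q p

near-sym : ∀ {m K p q} → Near m K p q → Near m K q p
near-sym (inj₁ sh) = inj₂ sh
near-sym (inj₂ sh) = inj₁ sh

-- If X + α ≡ Y + β with α, β ≤ B, then X and Y are within distance B:
-- the smaller of α, β cancels and the difference is the shift.
near-of-modEq : ∀ {m X Y α β B} → α ≤ B → β ≤ B → ModEq m (X + α) (Y + β) → Near m B X Y
near-of-modEq {X = X} {Y} {α} {β} αB βB c with ≤-total β α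
... | inj₁ β≤α = inj₁ (α ∸ β , ≤-trans (m∸n≤m α β) αB , modEq-cancelʳ β
      (modEq-trans (modEq-reflexive (trans (+-assoc X (α ∸ β) β) (cong (X +_) (m∸n+n≡m β≤α)))) c))
... | inj₂ α≤β = inj₂ (β ∸ α , ≤-trans (m∸n≤m β α) βB , modEq-cancelʳ α
      (modEq-trans (modEq-reflexive (trans (+-assoc Y (β ∸ α) α) (cong (Y +_) (m∸n+n≡m α≤β)))) (modEq-sym c)))

near-round-trip : ∀ {m s K a a₁ b j} →
  Shift m s a j → Shift m s a₁ j → Near m K a₁ b → Near m (s + K) a b
near-round-trip {s = s} {K} {a} {a₁} {b} (c₁ , c₁≤s , e₁) (c₂ , c₂≤s , e₂) (inj₁ (d , d≤K , e)) =
  -- a + (c₁ + d) ≡ j + d ≡ a₁ + c₂ + d ≡ b + c₂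
  near-of-modEq {α = c₁ + d} {β = c₂} (+-mono-≤ c₁≤s d≤K) (≤-trans c₂≤s (m≤m+n s K))
    (modEq-trans (modEq-reflexive (sym (+-assoc a c₁ d)))
    (modEq-trans (modEq-+ʳ d (modEq-trans e₁ (modEq-sym e₂)))
    (modEq-trans (modEq-reflexive (+-swapʳ a₁ c₂ d)) (modEq-+ʳ c₂ e))))
near-round-trip {s = s} {K} {a} {a₁} {b} (c₁ , c₁≤s , e₁) (c₂ , c₂≤s , e₂) (inj₂ (d , d≤K , e)) =
  -- b + (d + c₂) ≡ a₁ + c₂ ≡ j ≡ a + c₁
  near-sym (near-of-modEq {α = d + c₂} {β = c₁}
    (subst₂ _≤_ refl (+-comm K s) (+-mono-≤ d≤K c₂≤s)) (≤-trans c₁≤s (m≤m+n s K))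
    (modEq-trans (modEq-reflexive (sym (+-assoc b d c₂)))
    (modEq-trans (modEq-+ʳ c₂ e) (modEq-trans e₂ (modEq-sym e₁)))))

edge-shift : ∀ {Δ m} {i j : Fin m} → KEdge Δ m i j → Shift m (2 ^ (Δ ∸ 1) ∸ 1) (toℕ i) (toℕ j)
edge-shift {Δ} {m} {i} (k , k<Δ , j≡) =
  2 ^ k ∸ 1 , ∸-monoˡ-≤ 1 (^-monoʳ-≤ 2 (∸-monoˡ-≤ 1 k<Δ)) ,
  modEq-trans (modEq-sym (reduce-modEq (toℕ i + (2 ^ k ∸ 1)) m)) (modEq-reflexive (sym j≡))

walk-near : ∀ {Δ m} {a b : Fin m} → (w : Walk Δ m (U , a) (U , b)) →
  Σ ℕ λ t → length w ≡ 2 * t × Near m (t * (2 ^ (Δ ∸ 1) ∸ 1)) (toℕ a) (toℕ b)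
walk-near [] = 0 , refl , inj₁ (0 , z≤n , modEq-reflexive (+-identityʳ _))
walk-near (uv e₁ ∷ (vu e₂ ∷ w)) with walk-near w
... | t , |w|≡2t , near =
  suc t , trans (cong (λ l → 2 + l) |w|≡2t) (sym (*-suc 2 t)) ,
  near-round-trip (edge-shift e₁) (edge-shift e₂) near

modEq-lower : ∀ {m d i} → ModEq m d i → i < m → i ≤ d
modEq-lower {m} {d} {i} (x , y , e) i<m with ≤-<-connex x y
... | inj₁ x≤y = +-cancelʳ-≤ (x * m) i d
      (≤-trans (+-monoʳ-≤ i (*-monoˡ-≤ m x≤y)) (≤-reflexive (sym e)))
... | inj₂ y<x = ⊥-elim (<⇒≱ i<m (+-cancelʳ-≤ (y * m) m i
      (≤-trans (*-monoˡ-≤ m y<x) (≤-trans (m≤n+m (x * m) d) (≤-reflexive e)))))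

modEq-zero : ∀ {m a} → ModEq m a 0 → 1 ≤ a → m ≤ a
modEq-zero {m} {a} (x , y , e) 1≤a with ≤-<-connex y x
... | inj₁ y≤x = ⊥-elim (<⇒≱ 1≤a (+-cancelʳ-≤ (x * m) a 0
      (≤-trans (≤-reflexive e) (*-monoˡ-≤ m y≤x))))
... | inj₂ x<y = +-cancelʳ-≤ (x * m) m a (≤-trans (*-monoˡ-≤ m x<y) (≤-reflexive (sym e)))

near-zero-bound : ∀ {m K i} → Near m K 0 i → 1 ≤ i → i + i ≤ m → i ≤ K
near-zero-bound {i = suc i'} (inj₁ (d , d≤K , e)) _ 2i≤m =
  ≤-trans (modEq-lower e (≤-trans (s≤s (m≤n+m (suc i') i')) 2i≤m)) d≤K
near-zero-bound {i = i} (inj₂ (d , d≤K , e)) 1≤i 2i≤m =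
  ≤-trans (+-cancelˡ-≤ i i d (≤-trans 2i≤m (modEq-zero e (≤-trans 1≤i (m≤m+n i d))))) d≤K

ceil-le : ∀ s i t → 1 ≤ s → i ≤ t * s → ⌈ i / s ⌉ ≤ t
ceil-le (suc s') i t _ i≤ts = ≤-pred (m<n*o⇒m/o<n {i + s'} {suc t} {suc s'} (s≤s
  (≤-trans (+-monoˡ-≤ s' i≤ts) (≤-reflexive (+-comm (t * suc s') s')))))

double-le-half : ∀ i k → i ≤ k / 2 → i + i ≤ k
double-le-half i k i≤k/2 = ≤-trans (+-mono-≤ i≤k/2 i≤k/2)
  (≤-trans (≤-reflexive (sym (trans (*-comm (k / 2) 2) (cong (k / 2 +_) (+-identityʳ (k / 2))))))
  (m/n*n≤m k 2))

mainTheorem6 : (n Δ : ℕ) → n % 2 ≡ 0 → 2 ≤ Δ → Δ ≤ ⌊log₂ n ⌋ →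
    (i : ℕ) → 1 ≤ i → i ≤ n / 4 →
    (a b : Fin (n / 2)) → toℕ a ≡ 0 → toℕ b ≡ i →
    DistGE Δ (n / 2) (U , a) (U , b) (2 * ⌈ i / (2 ^ (Δ ∸ 1) ∸ 1) ⌉)
mainTheorem6 n Δ _ 2≤Δ _ i 1≤i i≤n/4 a b a≡0 b≡i w with walk-near w
... | t , |w|≡2t , near =
  ≤-trans (*-monoʳ-≤ 2 (ceil-le s i t 1≤s i≤ts)) (≤-reflexive (sym |w|≡2t))
  where
  s = 2 ^ (Δ ∸ 1) ∸ 1
  1≤s : 1 ≤ s
  1≤s = ∸-monoˡ-≤ 1 (^-monoʳ-≤ 2 (∸-monoˡ-≤ 1 2≤Δ))
  2i≤m : i + i ≤ n / 2
  2i≤m = double-le-half i (n / 2) (subst₂ _≤_ refl (sym (m/n/o≡m/[n*o] n 2 2)) i≤n/4)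
  i≤ts : i ≤ t * s
  i≤ts = near-zero-bound (subst₂ (Near (n / 2) (t * s)) a≡0 b≡i near) 1≤i 2i≤m
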